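{- $E_{\mathsf{ftc-cm}}\vdash x=x+1\to x=\bot$.
   Context: $\Sigma$ is the signature with constants $0,1,\bot$, unary $-$, binary $+,\cdot,\div$; $x\div y$ is written $\frac{x}{y}$. $E_{\mathsf{ftc-cm}}$ is the following set of equations: $(x+y)+z=x+(y+z)$; $x+y=y+x$; $x+0=x$; $x+(-x)=0\cdot x$; $x\cdot(y\cdot z)=(x\cdot y)\cdot z$; $x\cdot y=y\cdot x$; $1\cdot x=x$; $x\cdot(y+z)=(x\cdot y)+(x\cdot z)$; $-(-x)=x$; $0\cdot(x\cdot x)=0\cdot x$; $x+\bot=\bot$; $x=\frac{x}{1}$; $\frac{x}{y}\cdot\frac{u}{v}=\frac{x\cdot u}{y\cdot v}$; $\frac{x}{y}+\frac{u}{v}=\frac{(x\cdot v)+(y\cdot u)}{y\cdot v}$; $\frac{x}{y+(0\cdot z)}=\frac{x+(0\cdot z)}{y}$; $\bot=\frac{1}{0}$. $\vdash$ is derivability in conditional equational logic (equivalently first order logic). -}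

module Defs where

open import Level using (Level; suc)
open import Relation.Binary.PropositionalEquality using (_≡_)

record ΣAlgebra (a : Level) : Set (suc a) where
  field
    Carrier : Set a
    𝟎 𝟏 ⊥ₐ : Carrier
    -_ : Carrier → Carrier
    _+_ _·_ _÷_ : Carrier → Carrier → Carrier
  infixl 6 _+_
  infixl 7 _·_
  infixl 7 _÷_

record IsFtcCmModel {a : Level} (A : ΣAlgebra a) : Set a where
  open ΣAlgebra A
  field
    +-assoc   : ∀ x y z → (x + y) + z ≡ x + (y + z)
    +-comm    : ∀ x y → x + y ≡ y + x
    +-identʳ  : ∀ x → x + 𝟎 ≡ x
    +-inv     : ∀ x → x + (- x) ≡ 𝟎 · x
    ·-assoc   : ∀ x y z → x · (y · z) ≡ (x · y) · z
    ·-comm    : ∀ x y → x · y ≡ y · x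
    ·-identˡ  : ∀ x → 𝟏 · x ≡ x
    distrib   : ∀ x y z → x · (y + z) ≡ (x · y) + (x · z)
    neg-invol : ∀ x → - (- x) ≡ x
    zero-sq   : ∀ x → 𝟎 · (x · x) ≡ 𝟎 · x
    +-absorb  : ∀ x → x + ⊥ₐ ≡ ⊥ₐ
    div-one   : ∀ x → x ≡ x ÷ 𝟏
    div-mul   : ∀ x y u v → (x ÷ y) · (u ÷ v) ≡ (x · u) ÷ (y · v)
    div-add   : ∀ x y u v → (x ÷ y) + (u ÷ v) ≡ ((x · v) + (y · u)) ÷ (y · v)
    div-shift : ∀ x y z → x ÷ (y + (𝟎 · z)) ≡ (x + (𝟎 · z)) ÷ y
    bot-def   : ⊥ₐ ≡ 𝟏 ÷ 𝟎

record FtcCmModel (a : Level) : Set (suc a) where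
  field
    algebra : ΣAlgebra a
    isModel : IsFtcCmModel algebra
  open ΣAlgebra algebra public

{-# OPTIONS --safe #-}
-- From x = x + 1, adding - x gives 0·x + 1 = 0·x. The axiom moving a summand
-- 0·z between numerator and denominator then shows 0·x = 1 ÷ (0·x) = 0·x ÷ 0.
-- Finally x = x + 0·x = x + 0·x ÷ 0 = 0·x ÷ 0 = (0·x + 1) ÷ 0 = x + 1 ÷ 0 = ⊥.
module Submission where

open import Defs
open import Level using (Level)
open import Relation.Binary.PropositionalEquality using (_≡_; sym; trans; cong; cong₂; module ≡-Reasoning)

module FtcCmProperties {a : Level} (M : FtcCmModel a) where
  open FtcCmModel M
  open IsFtcCmModel isModel
  open ≡-Reasoning

  ·-identityʳ : ∀ x → x · 𝟏 ≡ x
  ·-identityʳ x = trans (·-comm x 𝟏) (·-identˡ x)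

  +-identityˡ : ∀ x → 𝟎 + x ≡ x
  +-identityˡ x = trans (+-comm 𝟎 x) (+-identʳ x)

  x+𝟎·x≡x : ∀ x → x + 𝟎 · x ≡ x
  x+𝟎·x≡x x = begin
    x + 𝟎 · x         ≡⟨ cong₂ _+_ (sym (·-identityʳ x)) (·-comm 𝟎 x) ⟩
    x · 𝟏 + x · 𝟎     ≡⟨ sym (distrib x 𝟏 𝟎) ⟩
    x · (𝟏 + 𝟎)       ≡⟨ cong (x ·_) (+-identʳ 𝟏) ⟩
    x · 𝟏             ≡⟨ ·-identityʳ x ⟩
    x                 ∎

  𝟎·x+𝟎·x≡𝟎·x : ∀ x → 𝟎 · x + 𝟎 · x ≡ 𝟎 · x
  𝟎·x+𝟎·x≡𝟎·x x = begin
    𝟎 · x + 𝟎 · x     ≡⟨ cong₂ _+_ (·-comm 𝟎 x) (·-comm 𝟎 x) ⟩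
    x · 𝟎 + x · 𝟎     ≡⟨ sym (distrib x 𝟎 𝟎) ⟩
    x · (𝟎 + 𝟎)       ≡⟨ cong (x ·_) (+-identʳ 𝟎) ⟩
    x · 𝟎             ≡⟨ ·-comm x 𝟎 ⟩
    𝟎 · x             ∎

  x+u÷𝟎≡[𝟎·x+u]÷𝟎 : ∀ x u → x + u ÷ 𝟎 ≡ (𝟎 · x + u) ÷ 𝟎
  x+u÷𝟎≡[𝟎·x+u]÷𝟎 x u = begin
    x + u ÷ 𝟎                    ≡⟨ cong (_+ u ÷ 𝟎) (div-one x) ⟩
    x ÷ 𝟏 + u ÷ 𝟎                ≡⟨ div-add x 𝟏 u 𝟎 ⟩
    (x · 𝟎 + 𝟏 · u) ÷ (𝟏 · 𝟎)    ≡⟨ cong₂ _÷_ (cong₂ _+_ (·-comm x 𝟎) (·-identˡ u)) (·-identˡ 𝟎) ⟩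
    (𝟎 · x + u) ÷ 𝟎              ∎

  x+𝟎·x÷𝟎≡𝟎·x÷𝟎 : ∀ x → x + 𝟎 · x ÷ 𝟎 ≡ 𝟎 · x ÷ 𝟎
  x+𝟎·x÷𝟎≡𝟎·x÷𝟎 x =
    trans (x+u÷𝟎≡[𝟎·x+u]÷𝟎 x (𝟎 · x)) (cong (_÷ 𝟎) (𝟎·x+𝟎·x≡𝟎·x x))

  ⊥≡[𝟎·x+𝟏]÷𝟎 : ∀ x → ⊥ₐ ≡ (𝟎 · x + 𝟏) ÷ 𝟎
  ⊥≡[𝟎·x+𝟏]÷𝟎 x = begin
    ⊥ₐ               ≡⟨ sym (+-absorb x) ⟩
    x + ⊥ₐ           ≡⟨ cong (x +_) bot-def ⟩
    x + 𝟏 ÷ 𝟎        ≡⟨ x+u÷𝟎≡[𝟎·x+u]÷𝟎 x 𝟏 ⟩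
    (𝟎 · x + 𝟏) ÷ 𝟎  ∎

  x≡x+𝟏⇒𝟎·x+𝟏≡𝟎·x : ∀ x → x ≡ x + 𝟏 → 𝟎 · x + 𝟏 ≡ 𝟎 · x
  x≡x+𝟏⇒𝟎·x+𝟏≡𝟎·x x x≡x+𝟏 = begin
    𝟎 · x + 𝟏        ≡⟨ cong (_+ 𝟏) (sym (+-inv x)) ⟩
    (x + - x) + 𝟏    ≡⟨ +-assoc x (- x) 𝟏 ⟩
    x + (- x + 𝟏)    ≡⟨ cong (x +_) (+-comm (- x) 𝟏) ⟩
    x + (𝟏 + - x)    ≡⟨ sym (+-assoc x 𝟏 (- x)) ⟩
    (x + 𝟏) + - x    ≡⟨ cong (_+ - x) (sym x≡x+𝟏) ⟩
    x + - x          ≡⟨ +-inv x ⟩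
    𝟎 · x            ∎

  𝟏÷[𝟏+𝟎·z]≡𝟏+𝟎·z : ∀ z → 𝟏 ÷ (𝟏 + 𝟎 · z) ≡ 𝟏 + 𝟎 · z
  𝟏÷[𝟏+𝟎·z]≡𝟏+𝟎·z z = trans (div-shift 𝟏 𝟏 z) (sym (div-one (𝟏 + 𝟎 · z)))

  𝟏÷𝟎·z≡[𝟏+𝟎·z]÷𝟎 : ∀ z → 𝟏 ÷ (𝟎 · z) ≡ (𝟏 + 𝟎 · z) ÷ 𝟎
  𝟏÷𝟎·z≡[𝟏+𝟎·z]÷𝟎 z =
    trans (cong (𝟏 ÷_) (sym (+-identityˡ (𝟎 · z)))) (div-shift 𝟏 𝟎 z)

  𝟏+𝟎·z≡𝟎·z⇒𝟎·z≡𝟎·z÷𝟎 : ∀ z → 𝟏 + 𝟎 · z ≡ 𝟎 · z → 𝟎 · z ≡ 𝟎 · z ÷ 𝟎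
  𝟏+𝟎·z≡𝟎·z⇒𝟎·z≡𝟎·z÷𝟎 z h = begin
    𝟎 · z                ≡⟨ sym h ⟩
    𝟏 + 𝟎 · z            ≡⟨ sym (𝟏÷[𝟏+𝟎·z]≡𝟏+𝟎·z z) ⟩
    𝟏 ÷ (𝟏 + 𝟎 · z)      ≡⟨ cong (𝟏 ÷_) h ⟩
    𝟏 ÷ (𝟎 · z)          ≡⟨ 𝟏÷𝟎·z≡[𝟏+𝟎·z]÷𝟎 z ⟩
    (𝟏 + 𝟎 · z) ÷ 𝟎      ≡⟨ cong (_÷ 𝟎) h ⟩
    𝟎 · z ÷ 𝟎            ∎

  x≡x+𝟏⇒x≡⊥ : ∀ x → x ≡ x + 𝟏 → x ≡ ⊥ₐ
  x≡x+𝟏⇒x≡⊥ x x≡x+𝟏 = begin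
    x                  ≡⟨ sym (x+𝟎·x≡x x) ⟩
    x + 𝟎 · x          ≡⟨ cong (x +_) (𝟏+𝟎·z≡𝟎·z⇒𝟎·z≡𝟎·z÷𝟎 x 𝟏+𝟎·x≡𝟎·x) ⟩
    x + 𝟎 · x ÷ 𝟎      ≡⟨ x+𝟎·x÷𝟎≡𝟎·x÷𝟎 x ⟩
    𝟎 · x ÷ 𝟎          ≡⟨ cong (_÷ 𝟎) (sym 𝟎·x+𝟏≡𝟎·x) ⟩
    (𝟎 · x + 𝟏) ÷ 𝟎    ≡⟨ sym (⊥≡[𝟎·x+𝟏]÷𝟎 x) ⟩
    ⊥ₐ                 ∎
    where
    𝟎·x+𝟏≡𝟎·x : 𝟎 · x + 𝟏 ≡ 𝟎 · x
    𝟎·x+𝟏≡𝟎·x = x≡x+𝟏⇒𝟎·x+𝟏≡𝟎·x x x≡x+𝟏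

    𝟏+𝟎·x≡𝟎·x : 𝟏 + 𝟎 · x ≡ 𝟎 · x
    𝟏+𝟎·x≡𝟎·x = trans (+-comm 𝟏 (𝟎 · x)) 𝟎·x+𝟏≡𝟎·x

mainTheorem13 : ∀ {a : Level} (M : FtcCmModel a) (x : FtcCmModel.Carrier M) →
    x ≡ FtcCmModel._+_ M x (FtcCmModel.𝟏 M) → x ≡ FtcCmModel.⊥ₐ M
mainTheorem13 M = FtcCmProperties.x≡x+𝟏⇒x≡⊥ M
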